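{- Let $\mathbf{A}\subseteq\mathbb{Z}^d$ be a VAS and let $\rho_0,\rho_1,\rho_2$ be runs of $\mathbf{A}$ with $\rho_0\trianglelefteq\rho_1$ and $\rho_0\trianglelefteq\rho_2$. Then there exists a run $\rho_3$ such that $\rho_1\trianglelefteq\rho_3$ and $\rho_2\trianglelefteq\rho_3$.
   Context: A VAS of dimension $d$ is a finite set $\mathbf{A}\subseteq\mathbb{Z}^d$; configurations are vectors of $\mathbb{N}^d$, ordered componentwise. A transition is a triple $(\mathbf{u},\mathbf{a},\mathbf{v})\in\mathbb{N}^d\times\mathbf{A}\times\mathbb{N}^d$ with $\mathbf{v}=\mathbf{u}+\mathbf{a}$. A prerun is $(\mathbf{u},w,\mathbf{v})$ with $\mathbf{u},\mathbf{v}\in\mathbb{N}^d$ and $w$ a finite word over $\mathbb{N}^d\times\mathbf{A}\times\mathbb{N}^d$. A prerun $(\mathbf{u},w,\mathbf{v})$ with $w=(\mathbf{u}_1,\mathbf{a}_1,\mathbf{v}_1)\cdots(\mathbf{u}_k,\mathbf{a}_k,\mathbf{v}_k)$ is a run if every letter is a transition and either $k=0$ and $\mathbf{u}=\mathbf{v}$, or $k>0$, $\mathbf{u}=\mathbf{u}_1$, $\mathbf{v}=\mathbf{v}_k$, $\mathbf{u}_{j+1}=\mathbf{v}_j$ for $1\le j<k$. Triples are ordered by $(\mathbf{u},\mathbf{a},\mathbf{v})\le(\mathbf{u}',\mathbf{a}',\mathbf{v}')$ iff $\mathbf{u}\le\mathbf{u}'$, $\mathbf{a}=\mathbf{a}'$,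 $\mathbf{v}\le\mathbf{v}'$; preruns are ordered by $(\mathbf{u},w,\mathbf{v})\trianglelefteq(\mathbf{u}',w',\mathbf{v}')$ iff $\mathbf{u}\le\mathbf{u}'$, $\mathbf{v}\le\mathbf{v}'$, and $w=t_1\cdots t_k$, $w'=w'_0t'_1w'_1\cdots t'_kw'_k$ for some words $w'_i$ and letters $t'_j$ with $t_j\le t'_j$. -}

module Defs where

open import Data.Nat using (ℕ)
open import Data.Integer as ℤ using (ℤ; +_)
open import Data.Vec using (Vec; []; _∷_; map; zipWith)
open import Data.Vec.Relation.Binary.Pointwise.Inductive using (Pointwise)
open import Data.List using (List; []; _∷_)
open import Data.List.Membership.Propositional using (_∈_)
open import Data.Product using (_×_; _,_)
open import Data.Unit using (⊤)
open import Relation.Binary.PropositionalEquality using (_≡_)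
import Data.Nat as ℕ

VAS : ℕ → Set
VAS d = List (Vec ℤ d)

Config : ℕ → Set
Config d = Vec ℕ d

_≤ᶜ_ : ∀ {d} → Config d → Config d → Set
u ≤ᶜ v = Pointwise ℕ._≤_ u v

toℤ : ∀ {d} → Config d → Vec ℤ d
toℤ = map +_

Triple : ℕ → Set
Triple d = Config d × Vec ℤ d × Config d

IsTransition : ∀ {d} → VAS d → Triple d → Set
IsTransition A (u , a , v) = (a ∈ A) × (toℤ v ≡ zipWith ℤ._+_ (toℤ u) a)

Prerun : ℕ → Set
Prerun d = Config d × List (Triple d) × Config d

AllTransitions : ∀ {d} → VAS d → List (Triple d) → Set
AllTransitions A [] = ⊤
AllTransitions A (t ∷ w) = IsTransition A t × AllTransitions A w

Chain : ∀ {d} → Config d → List (Triple d) → Config d → Set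
Chain u [] v = u ≡ v
Chain u ((u₁ , a , v₁) ∷ w) v = (u ≡ u₁) × Chain v₁ w v

IsRun : ∀ {d} → VAS d → Prerun d → Set
IsRun A (u , w , v) = AllTransitions A w × Chain u w v

_≤ᵗ_ : ∀ {d} → Triple d → Triple d → Set
(u , a , v) ≤ᵗ (u' , a' , v') = (u ≤ᶜ u') × (a ≡ a') × (v ≤ᶜ v')

-- w ⊑ w' : w' = w'₀ t'₁ w'₁ ⋯ t'ₖ w'ₖ with tⱼ ≤ t'ⱼ (ordered subword embedding)
data _⊑ʷ_ {d : ℕ} : List (Triple d) → List (Triple d) → Set where
  []⊑  : [] ⊑ʷ []
  skip : ∀ {w w' t'} → w ⊑ʷ w' → w ⊑ʷ (t' ∷ w')
  keep : ∀ {w w' t t'} → t ≤ᵗ t' → w ⊑ʷ w' → (t ∷ w) ⊑ʷ (t' ∷ w')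

_⊴_ : ∀ {d} → Prerun d → Prerun d → Set
(u , w , v) ⊴ (u' , w' , v') = (u ≤ᶜ u') × (w ⊑ʷ w') × (v ≤ᶜ v')

-- Transitions of a VAS are invariant under translation by any e ∈ ℕ^d, so raising a run
-- by e yields a run above it. Let ρ₀ start at c, and ρ₁, ρ₂ at c + e, c + f. The first
-- letter t of ρ₀ sits inside ρ₁ as t + g after a prefix x from c + e to c + g, and
-- inside ρ₂ as t + h after a prefix y from c + f to c + h. The common upper bound starts
-- at c + e + f with x + f, continues (from c + g + f) with y + g, then takes t + g + h,
-- and proceeds recursively with the rest of ρ₀ and the suffixes of ρ₁ and ρ₂.
module Submission where

open import Defs
open import Data.Nat using (ℕ)
open import Data.Product using (Σ; _×_)

import Data.Nat as ℕ
import Data.Nat.Properties as ℕₚ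
import Data.Integer as ℤ
import Data.Integer.Properties as ℤₚ
open import Algebra.Properties.CommutativeSemigroup ℤₚ.+-commutativeSemigroup
  using (xy∙z≈xz∙y)
open import Data.Integer using (ℤ; +_)
open import Data.List using (List; []; _∷_; _++_; map)
open import Data.Product using (_,_; Σ-syntax)
open import Data.Unit using (tt)
open import Data.Vec using (Vec; []; _∷_; zipWith)
open import Data.Vec.Properties using (zipWith-assoc; zipWith-comm; ∷-injectiveˡ; ∷-injectiveʳ)
open import Data.Vec.Relation.Binary.Pointwise.Inductive using ([]; _∷_)
open import Relation.Binary.PropositionalEquality
  using (_≡_; refl; sym; trans; cong; cong₂; subst; module ≡-Reasoning)

variable
  d : ℕ

infixl 30 _⊕_

_⊕_ : Config d → Config d → Config d
_⊕_ = zipWith ℕ._+_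

≤ᶜ⇒∃[e]u⊕e≡v : {u v : Config d} → u ≤ᶜ v → Σ[ e ∈ Config d ] u ⊕ e ≡ v
≤ᶜ⇒∃[e]u⊕e≡v [] = [] , refl
≤ᶜ⇒∃[e]u⊕e≡v (m≤n ∷ u≤v) with ℕₚ.m≤n⇒∃[o]m+o≡n m≤n | ≤ᶜ⇒∃[e]u⊕e≡v u≤v
... | k , m+k≡n | e , u⊕e≡v = k ∷ e , cong₂ _∷_ m+k≡n u⊕e≡v

u≤ᶜu⊕e : (u e : Config d) → u ≤ᶜ u ⊕ e
u≤ᶜu⊕e []       []       = []
u≤ᶜu⊕e (m ∷ u)  (k ∷ e)  = ℕₚ.m≤m+n m k ∷ u≤ᶜu⊕e u e


⊕-assoc : (x y z : Config d) → x ⊕ y ⊕ z ≡ x ⊕ (y ⊕ z)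
⊕-assoc = zipWith-assoc ℕₚ.+-assoc

⊕-comm : (x y : Config d) → x ⊕ y ≡ y ⊕ x
⊕-comm = zipWith-comm ℕₚ.+-comm

⊕-swap : (x y z : Config d) → x ⊕ y ⊕ z ≡ x ⊕ z ⊕ y
⊕-swap x y z = begin
  x ⊕ y ⊕ z    ≡⟨ ⊕-assoc x y z ⟩
  x ⊕ (y ⊕ z)  ≡⟨ cong (x ⊕_) (⊕-comm y z) ⟩
  x ⊕ (z ⊕ y)  ≡⟨ sym (⊕-assoc x z y) ⟩
  x ⊕ z ⊕ y    ∎
  where open ≡-Reasoning

u⊕e≤ᶜu⊕[e⊕f] : (u e f : Config d) → u ⊕ e ≤ᶜ u ⊕ (e ⊕ f)
u⊕e≤ᶜu⊕[e⊕f] u e f = subst (u ⊕ e ≤ᶜ_) (⊕-assoc u e f) (u≤ᶜu⊕e (u ⊕ e) f)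

u⊕f≤ᶜu⊕[e⊕f] : (u e f : Config d) → u ⊕ f ≤ᶜ u ⊕ (e ⊕ f)
u⊕f≤ᶜu⊕[e⊕f] u e f =
  subst (u ⊕ f ≤ᶜ_) (trans (⊕-assoc u f e) (cong (u ⊕_) (⊕-comm f e))) (u≤ᶜu⊕e (u ⊕ f) e)

toℤ-injective : {u v : Config d} → toℤ u ≡ toℤ v → u ≡ v
toℤ-injective {u = []}    {[]}    _  = refl
toℤ-injective {u = _ ∷ _} {_ ∷ _} eq =
  cong₂ _∷_ (ℤₚ.+-injective (∷-injectiveˡ eq)) (toℤ-injective (∷-injectiveʳ eq))

+v≡+u+a⇒+[v+e]≡+[u+e]+a : ∀ {u v : ℕ} {a : ℤ} (e : ℕ) →
  + v ≡ + u ℤ.+ a → + (v ℕ.+ e) ≡ + (u ℕ.+ e) ℤ.+ a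
+v≡+u+a⇒+[v+e]≡+[u+e]+a {u} {v} {a} e eq = begin
  + (v ℕ.+ e)           ≡⟨ ℤₚ.pos-+ v e ⟩
  + v ℤ.+ + e           ≡⟨ cong (ℤ._+ + e) eq ⟩
  + u ℤ.+ a ℤ.+ + e     ≡⟨ xy∙z≈xz∙y (+ u) a (+ e) ⟩
  + u ℤ.+ + e ℤ.+ a     ≡⟨ cong (ℤ._+ a) (sym (ℤₚ.pos-+ u e)) ⟩
  + (u ℕ.+ e) ℤ.+ a     ∎
  where open ≡-Reasoning

toℤ-step-⊕ : {u v : Config d} {a : Vec ℤ d} (e : Config d) →
  toℤ v ≡ zipWith ℤ._+_ (toℤ u) a → toℤ (v ⊕ e) ≡ zipWith ℤ._+_ (toℤ (u ⊕ e)) a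
toℤ-step-⊕ {u = []}    {[]}    {[]}    []      _  = refl
toℤ-step-⊕ {u = m ∷ _} {_ ∷ _} {a ∷ _} (k ∷ e) eq =
  cong₂ _∷_ (+v≡+u+a⇒+[v+e]≡+[u+e]+a {m} {a = a} k (∷-injectiveˡ eq)) (toℤ-step-⊕ e (∷-injectiveʳ eq))

shiftT : Config d → Triple d → Triple d
shiftT e (u , a , v) = u ⊕ e , a , v ⊕ e

shift : Config d → List (Triple d) → List (Triple d)
shift e = map (shiftT e)

t≤ᵗshiftT : (e : Config d) (t : Triple d) → t ≤ᵗ shiftT e t
t≤ᵗshiftT e (u , a , v) = u≤ᶜu⊕e u e , refl , u≤ᶜu⊕e v e

shiftT-≤ᵗ-⊕ˡ : (g h : Config d) (t : Triple d) → shiftT g t ≤ᵗ shiftT (g ⊕ h) t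
shiftT-≤ᵗ-⊕ˡ g h (u , a , v) = u⊕e≤ᶜu⊕[e⊕f] u g h , refl , u⊕e≤ᶜu⊕[e⊕f] v g h

shiftT-≤ᵗ-⊕ʳ : (g h : Config d) (t : Triple d) → shiftT h t ≤ᵗ shiftT (g ⊕ h) t
shiftT-≤ᵗ-⊕ʳ g h (u , a , v) = u⊕f≤ᶜu⊕[e⊕f] u g h , refl , u⊕f≤ᶜu⊕[e⊕f] v g h

[]⊑ʷ : (w : List (Triple d)) → [] ⊑ʷ w
[]⊑ʷ []      = []⊑
[]⊑ʷ (_ ∷ w) = skip ([]⊑ʷ w)

⊑ʷ-++ : {x X y Y : List (Triple d)} → x ⊑ʷ X → y ⊑ʷ Y → (x ++ y) ⊑ʷ (X ++ Y)
⊑ʷ-++ []⊑         y⊑Y = y⊑Y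
⊑ʷ-++ (skip x⊑X)  y⊑Y = skip (⊑ʷ-++ x⊑X y⊑Y)
⊑ʷ-++ (keep t≤ x⊑X) y⊑Y = keep t≤ (⊑ʷ-++ x⊑X y⊑Y)

⊑ʷ-++ˡ : (X : List (Triple d)) {y Y : List (Triple d)} → y ⊑ʷ Y → y ⊑ʷ (X ++ Y)
⊑ʷ-++ˡ X = ⊑ʷ-++ ([]⊑ʷ X)

⊑ʷ-++ʳ : {x X : List (Triple d)} (Y : List (Triple d)) → x ⊑ʷ X → x ⊑ʷ (X ++ Y)
⊑ʷ-++ʳ Y []⊑           = []⊑ʷ Y
⊑ʷ-++ʳ Y (skip x⊑X)    = skip (⊑ʷ-++ʳ Y x⊑X)
⊑ʷ-++ʳ Y (keep t≤ x⊑X) = keep t≤ (⊑ʷ-++ʳ Y x⊑X)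

w⊑ʷshift : (e : Config d) (w : List (Triple d)) → w ⊑ʷ shift e w
w⊑ʷshift e []      = []⊑
w⊑ʷshift e (t ∷ w) = keep (t≤ᵗshiftT e t) (w⊑ʷshift e w)

module _ (A : VAS d) where

  transition-shift : ∀ {t} (e : Config d) → IsTransition A t → IsTransition A (shiftT e t)
  transition-shift e (a∈A , step) = a∈A , toℤ-step-⊕ e step

  transition-deterministic : ∀ {u a v v'} →
    IsTransition A (u , a , v) → IsTransition A (u , a , v') → v ≡ v'
  transition-deterministic (_ , step) (_ , step') = toℤ-injective (trans step (sym step'))

  run-∷ : ∀ {u a m w v} → IsTransition A (u , a , m) → IsRun A (m , w , v) →
    IsRun A (u , (u , a , m) ∷ w , v)
  run-∷ τ (τs , chain) = (τ , τs) , refl , chain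

  run-++ : ∀ {u m v} x {y} → IsRun A (u , x , m) → IsRun A (m , y , v) → IsRun A (u , x ++ y , v)
  run-++ []      (_ , refl) ρ = ρ
  run-++ (_ ∷ x) ((τ , τs) , refl , chain) ρ = run-∷ τ (run-++ x (τs , chain) ρ)

  run-cast : ∀ {u u' w v v'} → u ≡ u' → v ≡ v' → IsRun A (u , w , v) → IsRun A (u' , w , v')
  run-cast refl refl ρ = ρ

  run-shift : ∀ {u v} (e : Config d) w → IsRun A (u , w , v) → IsRun A (u ⊕ e , shift e w , v ⊕ e)
  run-shift e []      (_ , refl) = tt , refl
  run-shift e (_ ∷ w) ((τ , τs) , refl , chain) =
    run-∷ (transition-shift e τ) (run-shift e w (τs , chain))

  run-interleave : ∀ {c e f g h} x y →
    IsRun A (c ⊕ e , x , c ⊕ g) → IsRun A (c ⊕ f , y , c ⊕ h) →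
    IsRun A (c ⊕ (e ⊕ f) , shift f x ++ shift g y , c ⊕ (g ⊕ h))
  run-interleave {c} {e} {f} {g} {h} x y ρx ρy = run-++ (shift f x)
    (run-cast (⊕-assoc c e f) (⊕-swap c g f) (run-shift f x ρx))
    (run-cast refl (trans (⊕-swap c h g) (⊕-assoc c g h)) (run-shift g y ρy))

  data RunThrough (u : Config d) (t : Triple d) (w₀ : List (Triple d)) (v : Config d) :
      List (Triple d) → Set where
    through : ∀ {x g w} → let (c , _ , c') = t in
      IsRun A (u , x , c ⊕ g) → IsRun A (c' ⊕ g , w , v) → w₀ ⊑ʷ w →
      RunThrough u t w₀ v (x ++ shiftT g t ∷ w)

  run-through : ∀ {u v t w₀} w → IsRun A (u , w , v) → IsTransition A t → (t ∷ w₀) ⊑ʷ w →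
    RunThrough u t w₀ v w
  run-through (_ ∷ w) ((τ , τs) , refl , chain) τ₀ (skip t∷w₀⊑w)
    with run-through w (τs , chain) τ₀ t∷w₀⊑w
  ... | through {x} ρx ρ' w₀⊑w' = through {x = _ ∷ x} (run-∷ τ ρx) ρ' w₀⊑w'
  -- The target of the matched letter is pinned to c' ⊕ g by determinism, not by ≤ᵗ.
  run-through {t = _ , _ , _} (_ ∷ w) ((τ , τs) , refl , chain) τ₀
    (keep (c≤b , refl , _) w₀⊑w) with ≤ᶜ⇒∃[e]u⊕e≡v c≤b
  ... | g , refl with transition-deterministic (transition-shift g τ₀) τ
  ... | refl = through {x = []} (tt , refl) (τs , chain) w₀⊑w

  UpperRunFrom : Config d → Prerun d → Prerun d → Set
  UpperRunFrom u ρ₁ ρ₂ = Σ[ w ∈ List (Triple d) ] Σ[ v ∈ Config d ]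
    IsRun A (u , w , v) × ρ₁ ⊴ (u , w , v) × ρ₂ ⊴ (u , w , v)

  amalgamate : ∀ {c e f v₀ v₁ v₂} w₀ {w₁ w₂} →
    IsRun A (c , w₀ , v₀) → IsRun A (c ⊕ e , w₁ , v₁) → IsRun A (c ⊕ f , w₂ , v₂) →
    w₀ ⊑ʷ w₁ → w₀ ⊑ʷ w₂ → v₀ ≤ᶜ v₁ → v₀ ≤ᶜ v₂ →
    UpperRunFrom (c ⊕ (e ⊕ f)) (c ⊕ e , w₁ , v₁) (c ⊕ f , w₂ , v₂)
  amalgamate {c} {e} {f} [] {w₁} {w₂} (_ , refl) ρ₁ ρ₂ _ _ c≤v₁ c≤v₂
    with ≤ᶜ⇒∃[e]u⊕e≡v c≤v₁ | ≤ᶜ⇒∃[e]u⊕e≡v c≤v₂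
  ... | g , refl | h , refl =
    shift f w₁ ++ shift g w₂ , c ⊕ (g ⊕ h) , run-interleave w₁ w₂ ρ₁ ρ₂ ,
    (u⊕e≤ᶜu⊕[e⊕f] c e f , ⊑ʷ-++ʳ (shift g w₂) (w⊑ʷshift f w₁) , u⊕e≤ᶜu⊕[e⊕f] c g h) ,
    (u⊕f≤ᶜu⊕[e⊕f] c e f , ⊑ʷ-++ˡ (shift f w₁) (w⊑ʷshift g w₂) , u⊕f≤ᶜu⊕[e⊕f] c g h)
  amalgamate {c} {e} {f} (t ∷ w₀) {w₁} {w₂} ((τ , τs) , refl , chain) ρ₁ ρ₂ t∷w₀⊑w₁ t∷w₀⊑w₂
    v₀≤v₁ v₀≤v₂
    with run-through w₁ ρ₁ τ t∷w₀⊑w₁ | run-through w₂ ρ₂ τ t∷w₀⊑w₂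
  ... | through {x} {g} ρx ρ₁' w₀⊑w₁' | through {y} {h} ρy ρ₂' w₀⊑w₂'
    with amalgamate w₀ (τs , chain) ρ₁' ρ₂' w₀⊑w₁' w₀⊑w₂' v₀≤v₁ v₀≤v₂
  ... | w₃ , v₃ , ρ₃ , (_ , w₁'⊑w₃ , v₁≤v₃) , (_ , w₂'⊑w₃ , v₂≤v₃) =
    (shift f x ++ shift g y) ++ shiftT (g ⊕ h) t ∷ w₃ , v₃ ,
    run-++ (shift f x ++ shift g y) (run-interleave x y ρx ρy)
      (run-∷ (transition-shift (g ⊕ h) τ) ρ₃) ,
    (u⊕e≤ᶜu⊕[e⊕f] c e f ,
      ⊑ʷ-++ (⊑ʷ-++ʳ (shift g y) (w⊑ʷshift f x)) (keep (shiftT-≤ᵗ-⊕ˡ g h t) w₁'⊑w₃) , v₁≤v₃) ,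
    (u⊕f≤ᶜu⊕[e⊕f] c e f ,
      ⊑ʷ-++ (⊑ʷ-++ˡ (shift f x) (w⊑ʷshift g y)) (keep (shiftT-≤ᵗ-⊕ʳ g h t) w₂'⊑w₃) , v₂≤v₃)

proposition5p1 : (d : ℕ) (A : VAS d) (ρ₀ ρ₁ ρ₂ : Prerun d) →
    IsRun A ρ₀ → IsRun A ρ₁ → IsRun A ρ₂ →
    ρ₀ ⊴ ρ₁ → ρ₀ ⊴ ρ₂ →
    Σ (Prerun d) (λ ρ₃ → IsRun A ρ₃ × ρ₁ ⊴ ρ₃ × ρ₂ ⊴ ρ₃)
proposition5p1 d A (u₀ , w₀ , _) _ _ ρ₀ ρ₁ ρ₂ (u₀≤u₁ , w₀⊑w₁ , v₀≤v₁) (u₀≤u₂ , w₀⊑w₂ , v₀≤v₂)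
  with ≤ᶜ⇒∃[e]u⊕e≡v u₀≤u₁ | ≤ᶜ⇒∃[e]u⊕e≡v u₀≤u₂
... | e , refl | f , refl
  with amalgamate A w₀ ρ₀ ρ₁ ρ₂ w₀⊑w₁ w₀⊑w₂ v₀≤v₁ v₀≤v₂
... | w₃ , v₃ , ρ₃ , ρ₁⊴ρ₃ , ρ₂⊴ρ₃ = (u₀ ⊕ (e ⊕ f) , w₃ , v₃) , ρ₃ , ρ₁⊴ρ₃ , ρ₂⊴ρ₃
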